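{- Let $T$ be a tree on $n$ vertices that has a perfect matching $M$ and is strongly graceful. Let $g_1$ be the permutation $(0\ 1)(2\ 3)\cdots(n-2\ n-1)$ of $\{0,1,\dots,n-1\}$, i.e. $g_1(a)=a+1$ for even $a$ and $g_1(a)=a-1$ for odd $a$. Then $g_1$ is a generalised strongly graceful permutation of $T$: for every strongly graceful labelling $f$ of $T$, the labelling $g_1\circ f$ is again a strongly graceful labelling of $T$.
   Context: A graceful labelling of a tree $T$ is a bijection $f:V(T)\to\{0,1,\dots,|E(T)|\}$ such that the induced edge labels $|f(u)-f(v)|$ ($uv\in E(T)$) are pairwise distinct. If $T$ has a perfect matching $M$, a strongly graceful labelling of $T$ is a graceful labelling $f$ with $f(x)+f(y)=|V(T)|-1$ for every $xy\in M$; $T$ is strongly graceful if it admits one. A permutation $g$ of $\{0,\dots,|V(T)|-1\}$ is a generalised strongly graceful permutation of $T$ if for every strongly graceful labelling $f$ of $T$, the labelling $g[f]=g\circ f$ is strongly graceful. -}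

module Defs where

open import Data.Nat using (ℕ; zero; suc; _+_; _∸_; _≤_; ∣_-_∣)
open import Data.Nat.Base using (pred)
open import Data.Fin using (Fin; toℕ) renaming (_<_ to _<ᶠ_)
open import Data.Fin.Properties using () renaming (_≟_ to _≟ᶠ_)
open import Data.Product using (Σ; ∃; _×_; _,_; proj₁; proj₂)
open import Data.Sum using (_⊎_)
open import Data.List using (List; []; _∷_; _++_; [_]; length; map; filter)
open import Data.List.Membership.Propositional using (_∈_)
open import Data.List.Relation.Unary.All using (All)
open import Data.List.Relation.Unary.Unique.Propositional using (Unique)
open import Data.List.Relation.Unary.Linked using (Linked)
open import Relation.Binary.PropositionalEquality using (_≡_)
open import Relation.Nullary using (¬_)
open import Relation.Nullary.Decidable using (_⊎-dec_)
open import Function.Definitions using (Injective)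

-- A finite simple graph on vertex set Fin n, given by its list of edges.
-- Each (unordered) edge {u,v} is stored once, as the pair (u , v) with u < v.
record Graph (n : ℕ) : Set where
  field
    edges   : List (Fin n × Fin n)
    ordered : All (λ e → proj₁ e <ᶠ proj₂ e) edges
    nodup   : Unique edges
open Graph public

module _ {n : ℕ} (G : Graph n) where

  Adj : Fin n → Fin n → Set
  Adj u v = ((u , v) ∈ edges G) ⊎ ((v , u) ∈ edges G)

  data Walk : Fin n → Fin n → Set where
    here : ∀ {u} → Walk u u
    step : ∀ {u w v} → Adj u w → Walk w v → Walk u v

  Connected : Set
  Connected = ∀ u v → Walk u v

  HasCycle : Set
  HasCycle = Σ (Fin n) λ x → Σ (List (Fin n)) λ xs →
    (2 ≤ length xs) × Unique (x ∷ xs) × Linked Adj (x ∷ xs ++ [ x ])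

  IsTree : Set
  IsTree = (1 ≤ n) × Connected × ¬ HasCycle

  covers? : (v : Fin n) (e : Fin n × Fin n) → _
  covers? v e = (proj₁ e ≟ᶠ v) ⊎-dec (proj₂ e ≟ᶠ v)

  IsPerfectMatching : List (Fin n × Fin n) → Set
  IsPerfectMatching M =
    All (_∈ edges G) M × (∀ v → length (filter (covers? v) M) ≡ 1)

  edgeLabel : (Fin n → ℕ) → Fin n × Fin n → ℕ
  edgeLabel f e = ∣ f (proj₁ e) - f (proj₂ e) ∣

  IsGraceful : (Fin n → ℕ) → Set
  IsGraceful f =
    Injective _≡_ _≡_ f
    × (∀ v → f v ≤ length (edges G))
    × (∀ k → k ≤ length (edges G) → ∃ λ v → f v ≡ k)
    × Unique (map (edgeLabel f) (edges G))

  IsStronglyGraceful : List (Fin n × Fin n) → (Fin n → ℕ) → Set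
  IsStronglyGraceful M f =
    IsGraceful f × All (λ e → f (proj₁ e) + f (proj₂ e) ≡ n ∸ 1) M

  StronglyGraceful : List (Fin n × Fin n) → Set
  StronglyGraceful M = ∃ λ f → IsStronglyGraceful M f


g₁ : ℕ → ℕ
g₁ zero = 1
g₁ (suc zero) = 0
g₁ (suc (suc a)) = suc (suc (g₁ a))

-- Write N = n − 1. A strongly graceful labelling f uses each of 0, …, N once and gives
-- the two ends of every matching edge labels x and N − x. So N is odd (otherwise N/2
-- would be matched with itself), and every label d of the parity of N is carried by a
-- matching edge, namely the one at the vertex labelled (N − d)/2. Since edge labels are
-- distinct, the edges with odd label sum (= odd label) are exactly the matching edges.
-- Now g₁ swaps 2k and 2k + 1: it leaves the label of every even-sum edge unchanged, and
-- it sends matching pairs {x, N − x} to matching pairs, among which the label determines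
-- the pair. Hence g₁ ∘ f still has distinct edge labels.
module Submission where

open import Defs
open import Data.Nat using (ℕ)
open import Data.Fin using (Fin)
open import Data.Product using (_×_)
open import Data.List using (List)
open import Function using (_∘_)

open import Data.Nat using (zero; suc; _+_; _*_; _∸_; _≤_; z≤n; s≤s; ∣_-_∣; ⌊_/2⌋; parity)
open import Data.Nat.Properties
open import Data.Parity.Base as ℙ using (0ℙ; 1ℙ; _⁻¹)
import Data.Parity.Properties as ℙ
import Data.Fin.Properties as Fin
open import Data.Product using (∃; _,_; proj₁; proj₂; swap)
open import Data.Sum as Sum using (_⊎_; inj₁; inj₂)
open import Data.Empty using (⊥; ⊥-elim)
open import Data.List using ([]; _∷_; length; map; filter)
open import Data.List.Membership.Propositional using (_∈_)
open import Data.List.Membership.Propositional.Properties using (∈-filter⁻; ∈-map⁻)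
open import Data.List.Relation.Unary.Any using (here; there)
open import Data.List.Relation.Unary.All as All using (All)
open import Data.List.Relation.Unary.All.Properties using (map⁻)
open import Data.List.Relation.Unary.AllPairs using (_∷_; [])
open import Data.List.Relation.Unary.Unique.Propositional using (Unique)
open import Relation.Binary.PropositionalEquality
open import Function.Definitions using (Injective)

module _ {A B : Set} where

  InjectiveOn : (A → B) → List A → Set
  InjectiveOn h xs = ∀ {x y} → x ∈ xs → y ∈ xs → h x ≡ h y → x ≡ y

  map⁻-injectiveOn : ∀ {h xs} → Unique (map h xs) → InjectiveOn h xs
  map⁻-injectiveOn _            (here refl) (here refl) _  = refl
  map⁻-injectiveOn (h∉ ∷ _)     (here refl) (there y∈) eq = ⊥-elim (All.lookup (map⁻ h∉) y∈ eq)
  map⁻-injectiveOn (h∉ ∷ _)     (there x∈) (here refl) eq = ⊥-elim (All.lookup (map⁻ h∉) x∈ (sym eq))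
  map⁻-injectiveOn (_ ∷ u)      (there x∈) (there y∈) eq = map⁻-injectiveOn u x∈ y∈ eq

  injectiveOn-map⁺ : ∀ {h xs} → Unique xs → InjectiveOn h xs → Unique (map h xs)
  injectiveOn-map⁺             []         _   = []
  injectiveOn-map⁺ {h} {x ∷ xs} (x∉ ∷ u) inj =
    All.tabulate differs ∷ injectiveOn-map⁺ u (λ p q → inj (there p) (there q))
    where
    differs : ∀ {z} → z ∈ map h xs → h x ≡ z → ⊥
    differs z∈ eq with ∈-map⁻ h z∈
    ... | y , y∈ , refl = All.lookup x∉ y∈ (inj (here refl) (there y∈) eq)

parity-∣-∣ : ∀ m n → parity ∣ m - n ∣ ≡ parity (m + n)
parity-∣-∣ zero    n       = refl
parity-∣-∣ (suc m) zero    = cong parity (sym (+-identityʳ (suc m)))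
parity-∣-∣ (suc m) (suc n) = trans (parity-∣-∣ m n) (cong (parity ∘ suc) (sym (+-suc m n)))

parity-∸ : ∀ {m n} → n ≤ m → parity (m ∸ n) ≡ parity m ℙ.+ parity n
parity-∸ {m} {n} n≤m = begin
  parity (m ∸ n)                               ≡⟨ sym (ℙ.+-identityʳ _) ⟩
  parity (m ∸ n) ℙ.+ 0ℙ                        ≡⟨ cong (parity (m ∸ n) ℙ.+_) (sym (ℙ.p+p≡0ℙ (parity n))) ⟩
  parity (m ∸ n) ℙ.+ (parity n ℙ.+ parity n)   ≡⟨ sym (ℙ.+-assoc (parity (m ∸ n)) _ _) ⟩
  parity (m ∸ n) ℙ.+ parity n ℙ.+ parity n     ≡⟨ cong (ℙ._+ parity n) (sym (ℙ.+-homo-+ (m ∸ n) n)) ⟩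
  parity (m ∸ n + n) ℙ.+ parity n              ≡⟨ cong (λ k → parity k ℙ.+ parity n) (m∸n+n≡m n≤m) ⟩
  parity m ℙ.+ parity n                        ∎
  where open ≡-Reasoning

even⇒⌊n/2⌋+⌊n/2⌋≡n : ∀ n → parity n ≡ 0ℙ → ⌊ n /2⌋ + ⌊ n /2⌋ ≡ n
even⇒⌊n/2⌋+⌊n/2⌋≡n zero          _    = refl
even⇒⌊n/2⌋+⌊n/2⌋≡n (suc (suc n)) even =
  cong suc (trans (+-suc ⌊ n /2⌋ ⌊ n /2⌋) (cong suc (even⇒⌊n/2⌋+⌊n/2⌋≡n n even)))

m+[m+o]≡n+[n+o]⇒m≡n : ∀ {m n} o → m + (m + o) ≡ n + (n + o) → m ≡ n
m+[m+o]≡n+[n+o]⇒m≡n {m} {n} o eq =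
  *-cancelˡ-≡ m n 2 (+-cancelʳ-≡ o (2 * m) (2 * n) (trans (double m) (trans eq (sym (double n)))))
  where
  double : ∀ k → 2 * k + o ≡ k + (k + o)
  double k = trans (cong (λ j → k + j + o) (+-identityʳ k)) (+-assoc k k o)

x+y≡a+[a+d]⇒∣x-y∣≡d : ∀ {x y a d} → x + y ≡ a + (a + d) → x ≡ a ⊎ y ≡ a → ∣ x - y ∣ ≡ d
x+y≡a+[a+d]⇒∣x-y∣≡d {a = a} {d} sum (inj₁ refl) =
  trans (cong (∣ a -_∣) (+-cancelˡ-≡ a _ _ sum)) (∣m-m+n∣≡n a d)
x+y≡a+[a+d]⇒∣x-y∣≡d {a = a} {d} sum (inj₂ refl) =
  trans (cong (∣_- a ∣) (+-cancelʳ-≡ a _ _ (trans sum (+-comm a (a + d)))))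
        (trans (∣-∣-comm (a + d) a) (∣m-m+n∣≡n a d))

≤-sum-∣-∣-injective : ∀ {a b c d} → a ≤ b → c ≤ d →
  a + b ≡ c + d → ∣ a - b ∣ ≡ ∣ c - d ∣ → a ≡ c × b ≡ d
≤-sum-∣-∣-injective {a} {b} {c} {d} a≤b c≤d sum diff =
  a≡c , +-cancelˡ-≡ a b d (trans sum (cong (_+ d) (sym a≡c)))
  where
  above : ∀ {m n} → m ≤ n → n ≡ m + ∣ m - n ∣
  above m≤n = trans (sym (m+[n∸m]≡n m≤n)) (cong (_ +_) (sym (m≤n⇒∣m-n∣≡n∸m m≤n)))
  a≡c : a ≡ c
  a≡c = m+[m+o]≡n+[n+o]⇒m≡n ∣ a - b ∣ (begin
    a + (a + ∣ a - b ∣)   ≡⟨ cong (a +_) (above a≤b) ⟨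
    a + b                 ≡⟨ sum ⟩
    c + d                 ≡⟨ cong (c +_) (above c≤d) ⟩
    c + (c + ∣ c - d ∣)   ≡⟨ cong (λ t → c + (c + t)) diff ⟨
    c + (c + ∣ a - b ∣)   ∎)
    where open ≡-Reasoning

sum-∣-∣-injective : ∀ {a b c d} → a + b ≡ c + d → ∣ a - b ∣ ≡ ∣ c - d ∣ →
  (a ≡ c × b ≡ d) ⊎ (a ≡ d × b ≡ c)
sum-∣-∣-injective {a} {b} {c} {d} sum diff with ≤-total a b | ≤-total c d
... | inj₁ a≤b | inj₁ c≤d = inj₁ (≤-sum-∣-∣-injective a≤b c≤d sum diff)
... | inj₁ a≤b | inj₂ d≤c = inj₂ (≤-sum-∣-∣-injective a≤b d≤c (trans sum (+-comm c d)) (trans diff (∣-∣-comm c d)))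
... | inj₂ b≤a | inj₁ c≤d = inj₂ (swap (≤-sum-∣-∣-injective b≤a c≤d (trans (+-comm b a) sum) (trans (∣-∣-comm b a) diff)))
... | inj₂ b≤a | inj₂ d≤c = inj₁ (swap (≤-sum-∣-∣-injective b≤a d≤c
                                          (trans (+-comm b a) (trans sum (+-comm c d)))
                                          (trans (∣-∣-comm b a) (trans diff (∣-∣-comm c d)))))

g₁-involutive : ∀ a → g₁ (g₁ a) ≡ a
g₁-involutive zero          = refl
g₁-involutive (suc zero)    = refl
g₁-involutive (suc (suc a)) = cong (suc ∘ suc) (g₁-involutive a)

g₁-injective : Injective _≡_ _≡_ g₁
g₁-injective {a} {b} eq = trans (sym (g₁-involutive a)) (trans (cong g₁ eq) (g₁-involutive b))

g₁-even : ∀ a → parity a ≡ 0ℙ → g₁ a ≡ suc a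
g₁-even zero          _    = refl
g₁-even (suc (suc a)) even = cong (suc ∘ suc) (g₁-even a even)

g₁-odd : ∀ a → parity a ≡ 1ℙ → suc (g₁ a) ≡ a
g₁-odd (suc zero)    _   = refl
g₁-odd (suc (suc a)) odd = cong (suc ∘ suc) (g₁-odd a odd)

parity-g₁ : ∀ a → parity (g₁ a) ≡ parity a ⁻¹
parity-g₁ zero          = refl
parity-g₁ (suc zero)    = refl
parity-g₁ (suc (suc a)) = parity-g₁ a

g₁-≤ : ∀ {N} a → parity N ≡ 1ℙ → a ≤ N → g₁ a ≤ N
g₁-≤ {suc _}        zero          _   _                = s≤s z≤n
g₁-≤                (suc zero)    _   _                = z≤n
g₁-≤ {suc (suc _)}  (suc (suc a)) odd (s≤s (s≤s a≤N)) = s≤s (s≤s (g₁-≤ a odd a≤N))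

g₁-+-odd : ∀ a b → parity (a + b) ≡ 1ℙ → g₁ a + g₁ b ≡ a + b
g₁-+-odd zero          b odd = g₁-odd b odd
g₁-+-odd (suc zero)    b odd = g₁-even b (trans (sym (ℙ.suc-homo-⁻¹ b)) (cong _⁻¹ odd))
g₁-+-odd (suc (suc a)) b odd = cong (suc ∘ suc) (g₁-+-odd a b odd)

parity-∣g₁-g₁∣ : ∀ a b → parity ∣ g₁ a - g₁ b ∣ ≡ parity (a + b)
parity-∣g₁-g₁∣ a b = begin
  parity ∣ g₁ a - g₁ b ∣               ≡⟨ parity-∣-∣ (g₁ a) (g₁ b) ⟩
  parity (g₁ a + g₁ b)                 ≡⟨ ℙ.+-homo-+ (g₁ a) (g₁ b) ⟩
  parity (g₁ a) ℙ.+ parity (g₁ b)      ≡⟨ cong₂ ℙ._+_ (parity-g₁ a) (parity-g₁ b) ⟩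
  parity a ⁻¹ ℙ.+ parity b ⁻¹          ≡⟨ ⁻¹+⁻¹ (parity a) (parity b) ⟩
  parity a ℙ.+ parity b                ≡⟨ sym (ℙ.+-homo-+ a b) ⟩
  parity (a + b)                       ∎
  where
  open ≡-Reasoning
  ⁻¹+⁻¹ : ∀ p q → p ⁻¹ ℙ.+ q ⁻¹ ≡ p ℙ.+ q
  ⁻¹+⁻¹ 0ℙ 0ℙ = refl
  ⁻¹+⁻¹ 0ℙ 1ℙ = refl
  ⁻¹+⁻¹ 1ℙ 0ℙ = refl
  ⁻¹+⁻¹ 1ℙ 1ℙ = refl

∣g₁-g₁∣-even : ∀ a b → parity (a + b) ≡ 0ℙ → ∣ g₁ a - g₁ b ∣ ≡ ∣ a - b ∣
∣g₁-g₁∣-even a b even with parity a in pa | parity b in pb | trans (sym (ℙ.+-homo-+ a b)) even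
... | 0ℙ | 0ℙ | _ = cong₂ ∣_-_∣ (g₁-even a pa) (g₁-even b pb)
... | 1ℙ | 1ℙ | _ = cong₂ ∣_-_∣ (g₁-odd a pa) (g₁-odd b pb)

∣g₁-g₁∣-odd-injective : ∀ a b c d → a + b ≡ c + d → parity (a + b) ≡ 1ℙ →
  ∣ g₁ a - g₁ b ∣ ≡ ∣ g₁ c - g₁ d ∣ → ∣ a - b ∣ ≡ ∣ c - d ∣
∣g₁-g₁∣-odd-injective a b c d sum odd diff
  with sum-∣-∣-injective {g₁ a} {g₁ b} {g₁ c} {g₁ d}
         (trans (g₁-+-odd a b odd) (trans sum (sym (g₁-+-odd c d (trans (cong parity (sym sum)) odd)))))
         diff
... | inj₁ (a≡c , b≡d) = cong₂ ∣_-_∣ (g₁-injective {a} a≡c) (g₁-injective {b} b≡d)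
... | inj₂ (a≡d , b≡c) = trans (cong₂ ∣_-_∣ (g₁-injective {a} a≡d) (g₁-injective {b} b≡c)) (∣-∣-comm d c)

edgeSum : ∀ {n} → (Fin n → ℕ) → Fin n × Fin n → ℕ
edgeSum f e = f (proj₁ e) + f (proj₂ e)

module Relabelling
  {n} (T : Graph n) {M : List (Fin n × Fin n)}
  (M⊆T : All (_∈ edges T) M)
  (covered : ∀ v → length (filter (covers? T v) M) ≡ 1)
  {f : Fin n → ℕ}
  (f-injective : Injective _≡_ _≡_ f)
  (f-bounded : ∀ v → f v ≤ length (edges T))
  (f-onto : ∀ k → k ≤ length (edges T) → ∃ λ v → f v ≡ k)
  (labels-distinct : Unique (map (edgeLabel T f) (edges T)))
  (matched-sum : All (λ e → edgeSum f e ≡ n ∸ 1) M)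
  where

  N : ℕ
  N = n ∸ 1

  matching-edge-at : ∀ v → ∃ λ m → m ∈ M × (proj₁ m ≡ v ⊎ proj₂ m ≡ v)
  matching-edge-at v with filter (covers? T v) M in eq | covered v
  ... | m ∷ [] | _ = m , ∈-filter⁻ (covers? T v) {xs = M} (subst (m ∈_) (sym eq) (here refl))

  partner : ∀ v → ∃ λ u → f v + f u ≡ N
  partner v with matching-edge-at v
  ... | m , m∈M , inj₁ refl = proj₂ m , All.lookup matched-sum m∈M
  ... | m , m∈M , inj₂ refl = proj₁ m , trans (+-comm (f v) _) (All.lookup matched-sum m∈M)

  f≤N : ∀ v → f v ≤ N
  f≤N v = let u , sum = partner v in subst (f v ≤_) sum (m≤m+n (f v) (f u))

  edges≡N : length (edges T) ≡ N
  edges≡N = ≤-antisym edges≤N N≤edges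
    where
    edges≤N : length (edges T) ≤ N
    edges≤N = let w , fw≡E = f-onto _ ≤-refl in subst (_≤ N) fw≡E (f≤N w)
    N≤edges : N ≤ length (edges T)
    N≤edges = let w , fw≡0 = f-onto 0 z≤n
                  u , sum  = partner w
              in subst (_≤ length (edges T)) (trans (cong (_+ f u) (sym fw≡0)) sum) (f-bounded u)

  matching-edge-labelled : ∀ d → d ≤ N → parity d ≡ parity N → ∃ λ m → m ∈ M × edgeLabel T f m ≡ d
  matching-edge-labelled d d≤N same =
    let w , fw≡a       = f-onto a a≤edges
        m , m∈M , w∈m = matching-edge-at w
    in m , m∈M , x+y≡a+[a+d]⇒∣x-y∣≡d (trans (All.lookup matched-sum m∈M) (sym a+[a+d]≡N))
                              (Sum.map (λ eq → trans (cong f eq) fw≡a) (λ eq → trans (cong f eq) fw≡a) w∈m)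
    where
    a : ℕ
    a = ⌊ (N ∸ d) /2⌋
    a+a≡N∸d : a + a ≡ N ∸ d
    a+a≡N∸d = even⇒⌊n/2⌋+⌊n/2⌋≡n (N ∸ d)
      (trans (parity-∸ d≤N) (trans (cong (parity N ℙ.+_) same) (ℙ.p+p≡0ℙ (parity N))))
    a+[a+d]≡N : a + (a + d) ≡ N
    a+[a+d]≡N = trans (sym (+-assoc a a d)) (trans (cong (_+ d) a+a≡N∸d) (m∸n+n≡m d≤N))
    a≤edges : a ≤ length (edges T)
    a≤edges = subst (a ≤_) (sym edges≡N)
      (≤-trans (m≤m+n a a) (subst (_≤ N) (sym a+a≡N∸d) (m∸n≤m N d)))

  N-odd : parity N ≡ 1ℙ
  N-odd with parity N in pN
  ... | 1ℙ = refl
  ... | 0ℙ = let m , m∈M , label≡0 = matching-edge-labelled 0 z≤n (sym pN)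
             in ⊥-elim (Fin.<-irrefl (f-injective (∣m-n∣≡0⇒m≡n label≡0))
                                     (All.lookup (ordered T) (All.lookup M⊆T m∈M)))

  odd-sum-edge⇒sum≡N : ∀ {e} → e ∈ edges T → parity (edgeSum f e) ≡ 1ℙ → edgeSum f e ≡ N
  odd-sum-edge⇒sum≡N {e} e∈T odd =
    let m , m∈M , same-label = matching-edge-labelled (edgeLabel T f e) label≤N
                                 (trans (parity-∣-∣ (f (proj₁ e)) (f (proj₂ e))) (trans odd (sym N-odd)))
    in subst (λ e → edgeSum f e ≡ N)
             (map⁻-injectiveOn labels-distinct (All.lookup M⊆T m∈M) e∈T same-label)
             (All.lookup matched-sum m∈M)
    where
    label≤N : edgeLabel T f e ≤ N
    label≤N = ≤-trans (∣m-n∣≤m⊔n (f (proj₁ e)) (f (proj₂ e))) (⊔-lub (f≤N (proj₁ e)) (f≤N (proj₂ e)))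

  g₁-preserves-label-equality : ∀ {e e'} → e ∈ edges T → e' ∈ edges T →
    edgeLabel T (g₁ ∘ f) e ≡ edgeLabel T (g₁ ∘ f) e' → edgeLabel T f e ≡ edgeLabel T f e'
  g₁-preserves-label-equality {x , y} {x' , y'} e∈T e'∈T eq
    with parity (f x + f y) in pe | parity (f x' + f y') in pe'
       | trans (sym (parity-∣g₁-g₁∣ (f x) (f y))) (trans (cong parity eq) (parity-∣g₁-g₁∣ (f x') (f y')))
  ... | 0ℙ | 0ℙ | _ = trans (sym (∣g₁-g₁∣-even (f x) (f y) pe)) (trans eq (∣g₁-g₁∣-even (f x') (f y') pe'))
  ... | 1ℙ | 1ℙ | _ = ∣g₁-g₁∣-odd-injective (f x) (f y) (f x') (f y')
                        (trans (odd-sum-edge⇒sum≡N e∈T pe) (sym (odd-sum-edge⇒sum≡N e'∈T pe'))) pe eq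
  ... | 0ℙ | 1ℙ | ()
  ... | 1ℙ | 0ℙ | ()

  edges-odd : parity (length (edges T)) ≡ 1ℙ
  edges-odd = trans (cong parity edges≡N) N-odd

  g₁∘f-bounded : ∀ v → g₁ (f v) ≤ length (edges T)
  g₁∘f-bounded v = g₁-≤ (f v) edges-odd (f-bounded v)

  g₁∘f-onto : ∀ k → k ≤ length (edges T) → ∃ λ v → g₁ (f v) ≡ k
  g₁∘f-onto k k≤edges =
    let v , fv≡g₁k = f-onto (g₁ k) (g₁-≤ k edges-odd k≤edges)
    in v , trans (cong g₁ fv≡g₁k) (g₁-involutive k)

  g₁∘f-labels-distinct : Unique (map (edgeLabel T (g₁ ∘ f)) (edges T))
  g₁∘f-labels-distinct = injectiveOn-map⁺ (nodup T)
    (λ p q eq → map⁻-injectiveOn labels-distinct p q (g₁-preserves-label-equality p q eq))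

  g₁∘f-matched-sum : All (λ e → edgeSum (g₁ ∘ f) e ≡ N) M
  g₁∘f-matched-sum = All.map
    (λ {(x , y)} sum → trans (g₁-+-odd (f x) (f y) (trans (cong parity sum) N-odd)) sum) matched-sum

theorem2 : (n : ℕ) (T : Graph n) → IsTree T → (M : List (Fin n × Fin n)) → IsPerfectMatching T M → StronglyGraceful T M → (f : Fin n → ℕ) → IsStronglyGraceful T M f → IsStronglyGraceful T M (g₁ ∘ f)
theorem2 n T _ M (M⊆T , covered) _ f ((f-injective , f-bounded , f-onto , labels-distinct) , matched-sum) =
  (f-injective ∘ g₁-injective , g₁∘f-bounded , g₁∘f-onto , g₁∘f-labels-distinct) , g₁∘f-matched-sum
  where open Relabelling T M⊆T covered f-injective f-bounded f-onto labels-distinct matched-sum
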